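{- Let $F(X,Z)\in\mathbb{Z}[1/3][X,Z]$ be a binary quartic form with good reduction away from $3$, i.e. $D(F)\in\mathbb{Z}[1/3]^\times$. Then the field system of $F$ is neither $(\mathbb{Q},\mathbb{Q},\mathbb{Q},\mathbb{Q})$ nor $(\mathbb{Q}(\zeta_3),\mathbb{Q}(\zeta_3))$, where $\zeta_3$ is a primitive cube root of unity.
   Context: For $F=\prod_{i=1}^4(\alpha_iX+\beta_iZ)$ (factored over an extension), $D(F)=\prod_{i<j}(\alpha_i\beta_j-\alpha_j\beta_i)^2$. If $F=\lambda F_1\cdots F_m$ with $\lambda\in\mathbb{Q}^\times$ and $F_j\in\mathbb{Q}[X,Z]$ irreducible, let $M_j\subseteq\overline{\mathbb{Q}}$ be a minimal extension of $\mathbb{Q}$ over which $F_j(x,1)$ has a root (with $M_j=\mathbb{Q}$ if $F_j=Z$); the field system of $F$ is the tuple $(M_1,\dots,M_m)$, well defined up to conjugation of the $M_j$ and reordering. -}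

module Defs where

open import Data.Nat using (ℕ; _^_)
open import Data.Rational using (ℚ; 0ℚ; 1ℚ; _+_; _*_; -_; _-_; ↧ₙ_)
open import Data.List using (List; []; _∷_; map)
open import Data.Product using (Σ; ∃; ∃-syntax; _×_; _,_)
open import Relation.Binary.PropositionalEquality using (_≡_; _≢_)
open import Relation.Nullary using (¬_)

InZ3 : ℚ → Set
InZ3 q = ∃[ k ] (↧ₙ q ≡ 3 ^ k)

IsUnitZ3 : ℚ → Set
IsUnitZ3 q = InZ3 q × (∃[ r ] (InZ3 r × q * r ≡ 1ℚ))

-- Binary forms over ℚ, as coefficient lists:
-- [c₀ , c₁ , … , cₙ] represents  Σ cᵢ X^(n-i) Z^i

addF : List ℚ → List ℚ → List ℚ
addF []      q       = q
addF (a ∷ p) []      = a ∷ p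
addF (a ∷ p) (b ∷ q) = (a + b) ∷ addF p q

-- product of binary forms:  (a X^m + Z·p) · q = a X^m q + Z (p q)
mulF : List ℚ → List ℚ → List ℚ
mulF []      q = []
mulF (a ∷ p) q = addF (map (a *_) q) (0ℚ ∷ mulF p q)

scaleF : ℚ → List ℚ → List ℚ
scaleF c p = map (c *_) p

quartic : ℚ → ℚ → ℚ → ℚ → ℚ → List ℚ
quartic a b c d e = a ∷ b ∷ c ∷ d ∷ e ∷ []

-- D(F) for F = a X⁴ + b X³Z + c X²Z² + d XZ³ + e Z⁴, i.e. the classical
-- discriminant polynomial, which equals ∏_{i<j} (αᵢβⱼ - αⱼβᵢ)² when
-- F = ∏ (αᵢ X + βᵢ Z) over an extension.
disc4 : ℚ → ℚ → ℚ → ℚ → ℚ → ℚ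
disc4 a b c d e =
    (256ℚ * a * a * a * e * e * e)
  - (192ℚ * a * a * b * d * e * e)
  - (128ℚ * a * a * c * c * e * e)
  + (144ℚ * a * a * c * d * d * e)
  - (27ℚ * a * a * d * d * d * d)
  + (144ℚ * a * b * b * c * e * e)
  - (6ℚ * a * b * b * d * d * e)
  - (80ℚ * a * b * c * c * d * e)
  + (18ℚ * a * b * c * d * d * d)
  + (16ℚ * a * c * c * c * c * e)
  - (4ℚ * a * c * c * c * d * d)
  - (27ℚ * b * b * b * b * e * e)
  + (18ℚ * b * b * b * c * d * e)
  - (4ℚ * b * b * b * d * d * d)
  - (4ℚ * b * b * c * c * c * e)
  + (b * b * c * c * d * d)
  where
  open import Data.Integer using (+_)
  open import Data.Rational using (_/_)
  256ℚ 192ℚ 128ℚ 144ℚ 27ℚ 6ℚ 80ℚ 18ℚ 16ℚ 4ℚ : ℚ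
  256ℚ = + 256 / 1
  192ℚ = + 192 / 1
  128ℚ = + 128 / 1
  144ℚ = + 144 / 1
  27ℚ  = + 27 / 1
  6ℚ   = + 6 / 1
  80ℚ  = + 80 / 1
  18ℚ  = + 18 / 1
  16ℚ  = + 16 / 1
  4ℚ   = + 4 / 1

-- a nonzero linear form α X + β Z (these are exactly the irreducible
-- linear forms; the associated field is ℚ)
NonzeroLinear : List ℚ → Set
NonzeroLinear L = ∃[ α ] ∃[ β ] (L ≡ α ∷ β ∷ [] × ¬ (α ≡ 0ℚ × β ≡ 0ℚ))

-- irreducible binary quadratic form over ℚ: nonzero and not a product
-- of two linear forms (every non-unit factor of a quadratic form is linear)
IrreducibleQuad : List ℚ → Set
IrreducibleQuad G =
  ∃[ g₀ ] ∃[ g₁ ] ∃[ g₂ ]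
    ( G ≡ g₀ ∷ g₁ ∷ g₂ ∷ []
    × ¬ (g₀ ≡ 0ℚ × g₁ ≡ 0ℚ × g₂ ≡ 0ℚ)
    × ¬ (∃[ p ] ∃[ q ] ∃[ r ] ∃[ s ] (G ≡ mulF (p ∷ q ∷ []) (r ∷ s ∷ []))) )

-- The field ℚ(ζ₃) = ℚ(ω) with ω² + ω + 1 = 0; elements u + v ω

record ℚζ₃ : Set where
  constructor _+_ω
  field
    re im : ℚ

infixl 6 _⊕_
infixl 7 _⊗_

_⊕_ : ℚζ₃ → ℚζ₃ → ℚζ₃
(a + b ω) ⊕ (c + d ω) = (a + c) + (b + d) ω

-- (a + bω)(c + dω) = ac + (ad + bc) ω + bd ω² , ω² = -1 - ω
_⊗_ : ℚζ₃ → ℚζ₃ → ℚζ₃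
(a + b ω) ⊗ (c + d ω) = (a * c - b * d) + (a * d + b * c - b * d) ω

ι : ℚ → ℚζ₃
ι q = q + 0ℚ ω

0ζ : ℚζ₃
0ζ = ι 0ℚ

HasRootInℚζ₃ : List ℚ → Set
HasRootInℚζ₃ G =
  ∃[ g₀ ] ∃[ g₁ ] ∃[ g₂ ]
    ( G ≡ g₀ ∷ g₁ ∷ g₂ ∷ []
    × ∃[ x ] (ι g₀ ⊗ x ⊗ x ⊕ ι g₁ ⊗ x ⊕ ι g₂ ≡ 0ζ) )

FieldSystemQQQQ : List ℚ → Set
FieldSystemQQQQ F =
  ∃[ λ′ ] ∃[ L₁ ] ∃[ L₂ ] ∃[ L₃ ] ∃[ L₄ ]
    ( λ′ ≢ 0ℚ
    × NonzeroLinear L₁ × NonzeroLinear L₂ × NonzeroLinear L₃ × NonzeroLinear L₄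
    × F ≡ scaleF λ′ (mulF L₁ (mulF L₂ (mulF L₃ L₄))) )

-- field system (ℚ(ζ₃),ℚ(ζ₃)): F = λ G₁ G₂ with Gᵢ irreducible quadratic
-- forms whose minimal root field is (conjugate to) ℚ(ζ₃); for an
-- irreducible quadratic this is the same as having a root in ℚ(ζ₃).
FieldSystemZetaZeta : List ℚ → Set
FieldSystemZetaZeta F =
  ∃[ λ′ ] ∃[ G₁ ] ∃[ G₂ ]
    ( λ′ ≢ 0ℚ
    × IrreducibleQuad G₁ × HasRootInℚζ₃ G₁
    × IrreducibleQuad G₂ × HasRootInℚζ₃ G₂
    × F ≡ scaleF λ′ (mulF G₁ G₂) )

-- Reduce modulo 2. Coefficients in ℤ[1/3] are 2-integral and units of ℤ[1/3] are odd, so F has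
-- separable reduction: whenever F = μ P with P 2-primitive, μ is 2-integral and D(F) = μ⁶ D(P) makes
-- D(P) odd. Every nonzero rational vector is a scalar multiple of a 2-primitive one, so in both field
-- systems F is a scalar multiple of a product of factors with nonzero reductions: four linear forms, or
-- two norm forms N(c X − (a + b ω) Z) from ℚ(ζ₃). Over 𝔽₂ there are only three lines, and a nonzero
-- norm form is a square or X² + XZ + Z²; either way the reduced product is nonzero with a repeated
-- factor, so its discriminant vanishes.

module Submission where

open import Defs
open import Data.Empty using (⊥; ⊥-elim)
open import Data.Fin using (Fin; #_)
open import Data.Integer.Base as ℤ using (ℤ; +_; +[1+_]; -[1+_]; _⊖_; ∣_∣)
open import Data.Integer.GCD using (gcd)
import Data.Integer.Properties as ℤ
open import Data.List.Base as List using (List; []; _∷_)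
import Data.List.Properties as List
open import Data.List.Relation.Binary.Pointwise as Pointwise using (Pointwise; []; _∷_)
open import Data.List.Relation.Unary.All using (All; []; _∷_)
open import Data.List.Relation.Unary.Any using (Any; here; there; any?)
open import Data.Nat.Base using (ℕ; zero; suc; parity; _^_)
open import Data.Nat.Coprimality using (coprime?)
open import Data.Nat.Divisibility using (_∣_; _∣0; n∣n; ∣m∣n⇒∣m+n)
open import Data.Parity.Base as ℙ using (Parity; 0ℙ; 1ℙ; _⁻¹)
import Data.Parity.Properties as ℙ
open import Data.Product.Base using (_×_; _,_; proj₁; proj₂; ∃-syntax)
open import Data.Rational.Base as ℚ
  using (ℚ; mkℚ; ↥_; ↧_; ↧ₙ_; _/_; 0ℚ; 1ℚ; 1/_; _+_; _*_; -_; _-_; NonZero; ≢-nonZero)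
import Data.Rational.Properties as ℚ
open import Data.Rational.Solver using (module +-*-Solver)
open import Data.Sum.Base using (_⊎_; inj₁; inj₂)
open import Data.Vec.Base as Vec using (Vec; []; _∷_; lookup)
import Data.Vec.Properties as Vec
import Data.Vec.Relation.Binary.Pointwise.Inductive as Vecᴾ
open import Data.Vec.Relation.Unary.All as VecAll using ([]; _∷_)
import Data.Vec.Relation.Unary.All.Properties as VecAll
open import Data.Vec.Relation.Unary.Any as VecAny using (here; there)
import Data.Vec.Relation.Unary.Any.Properties as VecAny
open import Function.Base using (_∘_)
open import Relation.Binary.PropositionalEquality
open import Relation.Nullary using (¬_; Dec; yes; no; contradiction)
open import Relation.Nullary.Decidable using (recompute; map′; _×-dec_; _→-dec_; from-yes)
open import Relation.Unary using (Decidable)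

-- Parity and 2-integral rationals

parityℤ : ℤ → Parity
parityℤ i = parity ∣ i ∣

⁻¹-+-⁻¹ : ∀ p q → p ⁻¹ ℙ.+ q ⁻¹ ≡ p ℙ.+ q
⁻¹-+-⁻¹ 0ℙ 0ℙ = refl
⁻¹-+-⁻¹ 0ℙ 1ℙ = refl
⁻¹-+-⁻¹ 1ℙ 0ℙ = refl
⁻¹-+-⁻¹ 1ℙ 1ℙ = refl

parity-suc-+-suc : ∀ m n → parity (suc m) ℙ.+ parity (suc n) ≡ parity m ℙ.+ parity n
parity-suc-+-suc m n = begin
  parity (suc m) ℙ.+ parity (suc n)            ≡⟨ ⁻¹-+-⁻¹ (parity (suc m)) (parity (suc n)) ⟨
  parity (suc m) ⁻¹ ℙ.+ parity (suc n) ⁻¹      ≡⟨ cong₂ ℙ._+_ (ℙ.suc-homo-⁻¹ m) (ℙ.suc-homo-⁻¹ n) ⟩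
  parity m ℙ.+ parity n                        ∎
  where open ≡-Reasoning

parityℤ-⊖ : ∀ m n → parityℤ (m ⊖ n) ≡ parity m ℙ.+ parity n
parityℤ-⊖ m       zero    = sym (ℙ.+-identityʳ (parity m))
parityℤ-⊖ zero    (suc n) = refl
parityℤ-⊖ (suc m) (suc n) = begin
  parityℤ (suc m ⊖ suc n)              ≡⟨ cong parityℤ (ℤ.[1+m]⊖[1+n]≡m⊖n m n) ⟩
  parityℤ (m ⊖ n)                      ≡⟨ parityℤ-⊖ m n ⟩
  parity m ℙ.+ parity n                ≡⟨ parity-suc-+-suc m n ⟨
  parity (suc m) ℙ.+ parity (suc n)    ∎
  where open ≡-Reasoning

parityℤ-+ : ∀ i j → parityℤ (i ℤ.+ j) ≡ parityℤ i ℙ.+ parityℤ j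
parityℤ-+ (+ m)    (+ n)    = ℙ.+-homo-+ m n
parityℤ-+ (+ m)    -[1+ n ] = parityℤ-⊖ m (suc n)
parityℤ-+ -[1+ m ] (+ n)    = trans (parityℤ-⊖ n (suc m)) (ℙ.+-comm (parity n) _)
parityℤ-+ -[1+ m ] -[1+ n ] = trans (ℙ.+-homo-+ m n) (sym (parity-suc-+-suc m n))

parityℤ-* : ∀ i j → parityℤ (i ℤ.* j) ≡ parityℤ i ℙ.* parityℤ j
parityℤ-* i j = trans (cong parity (ℤ.abs-* i j)) (ℙ.*-homo-* ∣ i ∣ ∣ j ∣)

parityℤ-neg : ∀ i → parityℤ (ℤ.- i) ≡ parityℤ i
parityℤ-neg i = cong parity (ℤ.∣-i∣≡∣i∣ i)

parity≡0ℙ⇒2∣ : ∀ n → parity n ≡ 0ℙ → 2 ∣ n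
parity≡0ℙ⇒2∣ zero          _    = 2 ∣0
parity≡0ℙ⇒2∣ (suc (suc n)) even = ∣m∣n⇒∣m+n (n∣n {2}) (parity≡0ℙ⇒2∣ n even)

parity-3^ : ∀ k → parity (3 ^ k) ≡ 1ℙ
parity-3^ zero    = refl
parity-3^ (suc k) = trans (ℙ.*-homo-* 3 (3 ^ k)) (parity-3^ k)

*≡1ℙ⇒≡1ℙ : ∀ {p q} → p ℙ.* q ≡ 1ℙ → p ≡ 1ℙ × q ≡ 1ℙ
*≡1ℙ⇒≡1ℙ {1ℙ} {1ℙ} _ = refl , refl

Integral₂ : ℚ → Set
Integral₂ q = parity (↧ₙ q) ≡ 1ℙ

-- Reduction modulo 2; a junk value unless q is 2-integral.
reduce : ℚ → Parity
reduce q = parityℤ (↥ q)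

infix 4 _↦₂_
record _↦₂_ (q : ℚ) (b : Parity) : Set where
  constructor _,_
  field
    integral : Integral₂ q
    reduce≡  : reduce q ≡ b

open _↦₂_

↦₂-reduce : ∀ q → Integral₂ q → q ↦₂ reduce q
↦₂-reduce q q-int = q-int , refl

¬Integral₂⇒reduce≡1ℙ : ∀ q → ¬ Integral₂ q → reduce q ≡ 1ℙ
¬Integral₂⇒reduce≡1ℙ (mkℚ n d-1 coprime) ¬int with parityℤ n in n-parity | parity (suc d-1) in d-parity
... | 1ℙ | _  = refl
... | 0ℙ | 1ℙ = ⊥-elim (¬int refl)
... | 0ℙ | 0ℙ with recompute (coprime? ∣ n ∣ (suc d-1)) coprime
                    (parity≡0ℙ⇒2∣ _ n-parity , parity≡0ℙ⇒2∣ _ d-parity)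
...   | ()

-- Every operation of ℚ computes an integer fraction N / D and then divides both by their gcd g.
reduced-fraction-↦₂ : ∀ r {g N D} → ↥ r ℤ.* g ≡ N → ↧ r ℤ.* g ≡ D → parityℤ D ≡ 1ℙ → r ↦₂ parityℤ N
reduced-fraction-↦₂ r {g} {N} ↥r*g≡N ↧r*g≡D D-odd = proj₁ odd-factors , (begin
  parityℤ (↥ r)                 ≡⟨ ℙ.*-identityʳ _ ⟨
  parityℤ (↥ r) ℙ.* 1ℙ          ≡⟨ cong (parityℤ (↥ r) ℙ.*_) (proj₂ odd-factors) ⟨
  parityℤ (↥ r) ℙ.* parityℤ g   ≡⟨ parityℤ-* (↥ r) g ⟨
  parityℤ (↥ r ℤ.* g)           ≡⟨ cong parityℤ ↥r*g≡N ⟩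
  parityℤ N                     ∎)
  where
  open ≡-Reasoning
  odd-factors : parityℤ (↧ r) ≡ 1ℙ × parityℤ g ≡ 1ℙ
  odd-factors = *≡1ℙ⇒≡1ℙ (trans (sym (parityℤ-* (↧ r) g)) (trans (cong parityℤ ↧r*g≡D) D-odd))

odd-denominator-* : ∀ p q → Integral₂ p → Integral₂ q → parityℤ (↧ p ℤ.* ↧ q) ≡ 1ℙ
odd-denominator-* p q p-int q-int = trans (parityℤ-* (↧ p) (↧ q)) (cong₂ ℙ._*_ p-int q-int)

↦₂-* : ∀ {p q a b} → p ↦₂ a → q ↦₂ b → p ℚ.* q ↦₂ a ℙ.* b
↦₂-* {p} {q} (p-int , refl) (q-int , refl) = integral pq↦ , trans (reduce≡ pq↦) (parityℤ-* (↥ p) (↥ q))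
  where pq↦ = reduced-fraction-↦₂ (p ℚ.* q) (ℚ.↥-* p q) (ℚ.↧-* p q) (odd-denominator-* p q p-int q-int)

↦₂-+ : ∀ {p q a b} → p ↦₂ a → q ↦₂ b → p ℚ.+ q ↦₂ a ℙ.+ b
↦₂-+ {p} {q} (p-int , refl) (q-int , refl) = integral p+q↦ , trans (reduce≡ p+q↦) numerator-parity
  where
  open ≡-Reasoning
  p+q↦ = reduced-fraction-↦₂ (p ℚ.+ q) (ℚ.↥-+ p q) (ℚ.↧-+ p q) (odd-denominator-* p q p-int q-int)
  numerator-parity : parityℤ (↥ p ℤ.* ↧ q ℤ.+ ↥ q ℤ.* ↧ p) ≡ reduce p ℙ.+ reduce q
  numerator-parity = begin
    parityℤ (↥ p ℤ.* ↧ q ℤ.+ ↥ q ℤ.* ↧ p)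
      ≡⟨ parityℤ-+ (↥ p ℤ.* ↧ q) (↥ q ℤ.* ↧ p) ⟩
    parityℤ (↥ p ℤ.* ↧ q) ℙ.+ parityℤ (↥ q ℤ.* ↧ p)
      ≡⟨ cong₂ ℙ._+_ (parityℤ-* (↥ p) (↧ q)) (parityℤ-* (↥ q) (↧ p)) ⟩
    (reduce p ℙ.* parityℤ (↧ q)) ℙ.+ (reduce q ℙ.* parityℤ (↧ p))
      ≡⟨ cong₂ (λ x y → (reduce p ℙ.* x) ℙ.+ (reduce q ℙ.* y)) q-int p-int ⟩
    (reduce p ℙ.* 1ℙ) ℙ.+ (reduce q ℙ.* 1ℙ)
      ≡⟨ cong₂ ℙ._+_ (ℙ.*-identityʳ (reduce p)) (ℙ.*-identityʳ (reduce q)) ⟩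
    reduce p ℙ.+ reduce q
      ∎

↦₂-neg : ∀ {p a} → p ↦₂ a → ℚ.- p ↦₂ a
↦₂-neg {p} (p-int , refl) =
  trans (cong (parity ∘ ∣_∣) (ℚ.↧-neg p)) p-int , trans (cong parityℤ (ℚ.↥-neg p)) (parityℤ-neg (↥ p))

↦₂-- : ∀ {p q a b} → p ↦₂ a → q ↦₂ b → p ℚ.- q ↦₂ a ℙ.+ b
↦₂-- p↦ q↦ = ↦₂-+ p↦ (↦₂-neg q↦)

↦₂-/1 : ∀ i → i / 1 ↦₂ parityℤ i
↦₂-/1 i = reduced-fraction-↦₂ (i / 1) (ℚ.↥-/ i 1) (ℚ.↧-/ i 1) refl

Integral₂-* : ∀ p q → Integral₂ p → Integral₂ q → Integral₂ (p * q)
Integral₂-* p q p-int q-int = integral (↦₂-* (↦₂-reduce p p-int) (↦₂-reduce q q-int))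

Integral₂-1/ : ∀ w .{{_ : NonZero w}} → ¬ Integral₂ w → Integral₂ (1/ w)
Integral₂-1/ w@(mkℚ +[1+ _ ] _ _) ¬w-int = ¬Integral₂⇒reduce≡1ℙ w ¬w-int
Integral₂-1/ w@(mkℚ -[1+ _ ] _ _) ¬w-int = ¬Integral₂⇒reduce≡1ℙ w ¬w-int

InZ3⇒Integral₂ : ∀ q → InZ3 q → Integral₂ q
InZ3⇒Integral₂ _ (k , ↧q≡3^k) = trans (cong parity ↧q≡3^k) (parity-3^ k)

IsUnitZ3⇒reduce≡1ℙ : ∀ q → IsUnitZ3 q → reduce q ≡ 1ℙ
IsUnitZ3⇒reduce≡1ℙ q (q-Z3 , r , r-Z3 , q*r≡1) =
  proj₁ (*≡1ℙ⇒≡1ℙ (trans (sym (reduce≡ qr↦)) (cong reduce q*r≡1)))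
  where qr↦ = ↦₂-* (↦₂-reduce q (InZ3⇒Integral₂ q q-Z3)) (↦₂-reduce r (InZ3⇒Integral₂ r r-Z3))

-- If μ were not 2-integral its numerator would be odd, so μ p would have an even denominator.
Integral₂-factor : ∀ μ p → Integral₂ (μ ℚ.* p) → reduce p ≡ 1ℙ → Integral₂ μ
Integral₂-factor μ p μp-int p-odd with parity (↧ₙ μ) ℙ.≟ 1ℙ
... | yes μ-int = μ-int
... | no ¬μ-int = ⊥-elim (¬μ-int (proj₁ (*≡1ℙ⇒≡1ℙ ↧μ↧p-odd)))
  where
  g = gcd (↥ μ ℤ.* ↥ p) (↧ μ ℤ.* ↧ p)
  g-odd : parityℤ g ≡ 1ℙ
  g-odd = proj₂ (*≡1ℙ⇒≡1ℙ (begin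
    parityℤ (↥ (μ ℚ.* p)) ℙ.* parityℤ g   ≡⟨ parityℤ-* (↥ (μ ℚ.* p)) g ⟨
    parityℤ (↥ (μ ℚ.* p) ℤ.* g)           ≡⟨ cong parityℤ (ℚ.↥-* μ p) ⟩
    parityℤ (↥ μ ℤ.* ↥ p)                 ≡⟨ parityℤ-* (↥ μ) (↥ p) ⟩
    reduce μ ℙ.* reduce p                 ≡⟨ cong₂ ℙ._*_ (¬Integral₂⇒reduce≡1ℙ μ ¬μ-int) p-odd ⟩
    1ℙ                                    ∎))
    where open ≡-Reasoning
  ↧μ↧p-odd : parityℤ (↧ μ) ℙ.* parityℤ (↧ p) ≡ 1ℙ
  ↧μ↧p-odd = begin
    parityℤ (↧ μ) ℙ.* parityℤ (↧ p)       ≡⟨ parityℤ-* (↧ μ) (↧ p) ⟨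
    parityℤ (↧ μ ℤ.* ↧ p)                 ≡⟨ cong parityℤ (ℚ.↧-* μ p) ⟨
    parityℤ (↧ (μ ℚ.* p) ℤ.* g)           ≡⟨ parityℤ-* (↧ (μ ℚ.* p)) g ⟩
    parityℤ (↧ (μ ℚ.* p)) ℙ.* parityℤ g   ≡⟨ cong₂ ℙ._*_ μp-int g-odd ⟩
    1ℙ                                    ∎
    where open ≡-Reasoning

-- Binary forms over 𝔽₂

addF₂ : List Parity → List Parity → List Parity
addF₂ []      q       = q
addF₂ (a ∷ p) []      = a ∷ p
addF₂ (a ∷ p) (b ∷ q) = (a ℙ.+ b) ∷ addF₂ p q

mulF₂ : List Parity → List Parity → List Parity
mulF₂ []      q = []
mulF₂ (a ∷ p) q = addF₂ (List.map (a ℙ.*_) q) (0ℙ ∷ mulF₂ p q)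

infix 4 _↦ₚ_
_↦ₚ_ : List ℚ → List Parity → Set
_↦ₚ_ = Pointwise _↦₂_

0↦₂0ℙ : 0ℚ ↦₂ 0ℙ
0↦₂0ℙ = refl , refl

addF-↦ₚ : ∀ {p q p₂ q₂} → p ↦ₚ p₂ → q ↦ₚ q₂ → addF p q ↦ₚ addF₂ p₂ q₂
addF-↦ₚ []           q↦ₚ          = q↦ₚ
addF-↦ₚ (a↦ ∷ p↦ₚ)   []           = a↦ ∷ p↦ₚ
addF-↦ₚ (a↦ ∷ p↦ₚ)   (b↦ ∷ q↦ₚ)   = ↦₂-+ a↦ b↦ ∷ addF-↦ₚ p↦ₚ q↦ₚ

scaleF-↦ₚ : ∀ {μ r q q₂} → μ ↦₂ r → q ↦ₚ q₂ → scaleF μ q ↦ₚ List.map (r ℙ.*_) q₂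
scaleF-↦ₚ μ↦ q↦ₚ = Pointwise.map⁺ _ _ (Pointwise.map (↦₂-* μ↦) q↦ₚ)

mulF-↦ₚ : ∀ {p q p₂ q₂} → p ↦ₚ p₂ → q ↦ₚ q₂ → mulF p q ↦ₚ mulF₂ p₂ q₂
mulF-↦ₚ []         q↦ₚ = []
mulF-↦ₚ (a↦ ∷ p↦ₚ) q↦ₚ = addF-↦ₚ (scaleF-↦ₚ a↦ q↦ₚ) (0↦₂0ℙ ∷ mulF-↦ₚ p↦ₚ q↦ₚ)

infixl 6 _⊞_ _⊟_
infixl 7 _⊠_

data Expr (n : ℕ) : Set where
  var         : Fin n → Expr n
  lit         : ℤ → Expr n
  _⊞_ _⊟_ _⊠_ : Expr n → Expr n → Expr n

⟦_⟧ : ∀ {n} → Expr n → Vec ℚ n → ℚ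
⟦ var i ⟧ ρ = lookup ρ i
⟦ lit i ⟧ ρ = i / 1
⟦ e ⊞ f ⟧ ρ = ⟦ e ⟧ ρ ℚ.+ ⟦ f ⟧ ρ
⟦ e ⊟ f ⟧ ρ = ⟦ e ⟧ ρ ℚ.- ⟦ f ⟧ ρ
⟦ e ⊠ f ⟧ ρ = ⟦ e ⟧ ρ ℚ.* ⟦ f ⟧ ρ

⟦_⟧₂ : ∀ {n} → Expr n → Vec Parity n → Parity
⟦ var i ⟧₂ σ = lookup σ i
⟦ lit i ⟧₂ σ = parityℤ i
⟦ e ⊞ f ⟧₂ σ = ⟦ e ⟧₂ σ ℙ.+ ⟦ f ⟧₂ σ
⟦ e ⊟ f ⟧₂ σ = ⟦ e ⟧₂ σ ℙ.+ ⟦ f ⟧₂ σ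
⟦ e ⊠ f ⟧₂ σ = ⟦ e ⟧₂ σ ℙ.* ⟦ f ⟧₂ σ

⟦⟧-↦₂ : ∀ {n} (e : Expr n) {ρ σ} → Vecᴾ.Pointwise _↦₂_ ρ σ → ⟦ e ⟧ ρ ↦₂ ⟦ e ⟧₂ σ
⟦⟧-↦₂ (var i) ρ↦σ = Vecᴾ.lookup ρ↦σ i
⟦⟧-↦₂ (lit i) ρ↦σ = ↦₂-/1 i
⟦⟧-↦₂ (e ⊞ f) ρ↦σ = ↦₂-+ (⟦⟧-↦₂ e ρ↦σ) (⟦⟧-↦₂ f ρ↦σ)
⟦⟧-↦₂ (e ⊟ f) ρ↦σ = ↦₂-- (⟦⟧-↦₂ e ρ↦σ) (⟦⟧-↦₂ f ρ↦σ)
⟦⟧-↦₂ (e ⊠ f) ρ↦σ = ↦₂-* (⟦⟧-↦₂ e ρ↦σ) (⟦⟧-↦₂ f ρ↦σ)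

discExpr : Expr 5
discExpr =
    (lit (+ 256) ⊠ A ⊠ A ⊠ A ⊠ E ⊠ E ⊠ E)
  ⊟ (lit (+ 192) ⊠ A ⊠ A ⊠ B ⊠ D ⊠ E ⊠ E)
  ⊟ (lit (+ 128) ⊠ A ⊠ A ⊠ C ⊠ C ⊠ E ⊠ E)
  ⊞ (lit (+ 144) ⊠ A ⊠ A ⊠ C ⊠ D ⊠ D ⊠ E)
  ⊟ (lit (+ 27) ⊠ A ⊠ A ⊠ D ⊠ D ⊠ D ⊠ D)
  ⊞ (lit (+ 144) ⊠ A ⊠ B ⊠ B ⊠ C ⊠ E ⊠ E)
  ⊟ (lit (+ 6) ⊠ A ⊠ B ⊠ B ⊠ D ⊠ D ⊠ E)
  ⊟ (lit (+ 80) ⊠ A ⊠ B ⊠ C ⊠ C ⊠ D ⊠ E)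
  ⊞ (lit (+ 18) ⊠ A ⊠ B ⊠ C ⊠ D ⊠ D ⊠ D)
  ⊞ (lit (+ 16) ⊠ A ⊠ C ⊠ C ⊠ C ⊠ C ⊠ E)
  ⊟ (lit (+ 4) ⊠ A ⊠ C ⊠ C ⊠ C ⊠ D ⊠ D)
  ⊟ (lit (+ 27) ⊠ B ⊠ B ⊠ B ⊠ B ⊠ E ⊠ E)
  ⊞ (lit (+ 18) ⊠ B ⊠ B ⊠ B ⊠ C ⊠ D ⊠ E)
  ⊟ (lit (+ 4) ⊠ B ⊠ B ⊠ B ⊠ D ⊠ D ⊠ D)
  ⊟ (lit (+ 4) ⊠ B ⊠ B ⊠ C ⊠ C ⊠ C ⊠ E)
  ⊞ (B ⊠ B ⊠ C ⊠ C ⊠ D ⊠ D)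
  where
  A B C D E : Expr 5
  A = var (# 0)
  B = var (# 1)
  C = var (# 2)
  D = var (# 3)
  E = var (# 4)

-- The discriminant of a binary quartic over 𝔽₂; a junk value on lists of other lengths.
disc₂ : List Parity → Parity
disc₂ (a ∷ b ∷ c ∷ d ∷ e ∷ []) = ⟦ discExpr ⟧₂ (a ∷ b ∷ c ∷ d ∷ e ∷ [])
disc₂ _                        = 0ℙ

disc4-↦₂ : ∀ {a b c d e F₂} → quartic a b c d e ↦ₚ F₂ → disc4 a b c d e ↦₂ disc₂ F₂
disc4-↦₂ (a↦ ∷ b↦ ∷ c↦ ∷ d↦ ∷ e↦ ∷ []) = ⟦⟧-↦₂ discExpr (a↦ Vecᴾ.∷ b↦ Vecᴾ.∷ c↦ Vecᴾ.∷ d↦ Vecᴾ.∷ e↦ Vecᴾ.∷ Vecᴾ.[])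

disc₂-homogeneous : ∀ r s₀ s₁ s₂ s₃ s₄ →
  disc₂ (List.map (r ℙ.*_) (s₀ ∷ s₁ ∷ s₂ ∷ s₃ ∷ s₄ ∷ [])) ≡ r ℙ.* disc₂ (s₀ ∷ s₁ ∷ s₂ ∷ s₃ ∷ s₄ ∷ [])
disc₂-homogeneous 0ℙ _ _ _ _ _ = refl
disc₂-homogeneous 1ℙ _ _ _ _ _ = refl

Inseparable₂ : List Parity → Set
Inseparable₂ F = Any (_≡ 1ℙ) F × disc₂ F ≡ 0ℙ

Integral₂-scalar : ∀ μ {P P₂} → P ↦ₚ P₂ → All Integral₂ (scaleF μ P) → Any (_≡ 1ℙ) P₂ → Integral₂ μ
Integral₂-scalar μ ((_ , p-odd) ∷ _) (μp-int ∷ _)   (here refl)  = Integral₂-factor μ _ μp-int p-odd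
Integral₂-scalar μ   (_ ∷ P↦ₚ)         (_ ∷ μP-int)   (there odd)  = Integral₂-scalar μ P↦ₚ μP-int odd

-- D(μ P) = μ⁶ D(P), and μ is 2-integral because P is primitive, so D(P) is odd along with D(μ P).
good-reduction⇒separable : ∀ {a b c d e} →
  All Integral₂ (quartic a b c d e) → reduce (disc4 a b c d e) ≡ 1ℙ →
  ∀ μ {P s₀ s₁ s₂ s₃ s₄} → quartic a b c d e ≡ scaleF μ P → P ↦ₚ s₀ ∷ s₁ ∷ s₂ ∷ s₃ ∷ s₄ ∷ [] →
  ¬ Inseparable₂ (s₀ ∷ s₁ ∷ s₂ ∷ s₃ ∷ s₄ ∷ [])
good-reduction⇒separable {a} {b} {c} {d} {e} F-int disc-odd μ {P} {s₀} {s₁} {s₂} {s₃} {s₄} F≡μP P↦ₚ (P₂≢0 , disc₂≡0) =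
  contradiction 1ℙ≡0ℙ λ ()
  where
  P₂ = s₀ ∷ s₁ ∷ s₂ ∷ s₃ ∷ s₄ ∷ []
  μ-int : Integral₂ μ
  μ-int = Integral₂-scalar μ P↦ₚ (subst (All Integral₂) F≡μP F-int) P₂≢0
  F↦ₚ : quartic a b c d e ↦ₚ List.map (reduce μ ℙ.*_) P₂
  F↦ₚ = subst (_↦ₚ _) (sym F≡μP) (scaleF-↦ₚ (↦₂-reduce μ μ-int) P↦ₚ)
  1ℙ≡0ℙ : 1ℙ ≡ 0ℙ
  1ℙ≡0ℙ = begin
    1ℙ                                          ≡⟨ disc-odd ⟨
    reduce (disc4 a b c d e)                    ≡⟨ reduce≡ (disc4-↦₂ F↦ₚ) ⟩
    disc₂ (List.map (reduce μ ℙ.*_) P₂)          ≡⟨ disc₂-homogeneous (reduce μ) s₀ s₁ s₂ s₃ s₄ ⟩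
    reduce μ ℙ.* disc₂ P₂                       ≡⟨ cong (reduce μ ℙ.*_) disc₂≡0 ⟩
    reduce μ ℙ.* 0ℙ                             ≡⟨ ℙ.*-zeroʳ (reduce μ) ⟩
    0ℙ                                          ∎
    where open ≡-Reasoning

∀-Parity? : {P : Parity → Set} → Decidable P → Dec (∀ p → P p)
∀-Parity? P? = map′ (λ (p₀ , p₁) → λ { 0ℙ → p₀ ; 1ℙ → p₁ }) (λ ∀P → ∀P 0ℙ , ∀P 1ℙ) (P? 0ℙ ×-dec P? 1ℙ)

Nonzero₂ : ∀ {n} → Vec Parity n → Set
Nonzero₂ = VecAny.Any (_≡ 1ℙ)

nonzero₂? : ∀ {n} → Decidable (Nonzero₂ {n})
nonzero₂? = VecAny.any? (ℙ._≟ 1ℙ)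

inseparable₂? : Decidable Inseparable₂
inseparable₂? F = any? (ℙ._≟ 1ℙ) F ×-dec disc₂ F ℙ.≟ 0ℙ

-- ℙ¹(𝔽₂) has only three points, so two of the four lines coincide.
four-lines₂ : ∀ a₁ b₁ a₂ b₂ a₃ b₃ a₄ b₄ →
  Nonzero₂ (a₁ ∷ b₁ ∷ []) → Nonzero₂ (a₂ ∷ b₂ ∷ []) → Nonzero₂ (a₃ ∷ b₃ ∷ []) → Nonzero₂ (a₄ ∷ b₄ ∷ []) →
  Inseparable₂ (mulF₂ (a₁ ∷ b₁ ∷ []) (mulF₂ (a₂ ∷ b₂ ∷ []) (mulF₂ (a₃ ∷ b₃ ∷ []) (a₄ ∷ b₄ ∷ []))))
four-lines₂ = from-yes
  ( ∀-Parity? λ a₁ → ∀-Parity? λ b₁ → ∀-Parity? λ a₂ → ∀-Parity? λ b₂ →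
    ∀-Parity? λ a₃ → ∀-Parity? λ b₃ → ∀-Parity? λ a₄ → ∀-Parity? λ b₄ →
    nonzero₂? (a₁ ∷ b₁ ∷ []) →-dec nonzero₂? (a₂ ∷ b₂ ∷ []) →-dec
    nonzero₂? (a₃ ∷ b₃ ∷ []) →-dec nonzero₂? (a₄ ∷ b₄ ∷ []) →-dec
    inseparable₂? (mulF₂ (a₁ ∷ b₁ ∷ []) (mulF₂ (a₂ ∷ b₂ ∷ []) (mulF₂ (a₃ ∷ b₃ ∷ []) (a₄ ∷ b₄ ∷ [])))))

-- Primitive multiples

*-1/-cancelˡ : ∀ t x .{{_ : NonZero t}} → t * (1/ t * x) ≡ x
*-1/-cancelˡ t x = begin
  t * (1/ t * x)   ≡⟨ ℚ.*-assoc t (1/ t) x ⟨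
  t * 1/ t * x     ≡⟨ cong (_* x) (ℚ.*-inverseʳ t) ⟩
  1ℚ * x           ≡⟨ ℚ.*-identityˡ x ⟩
  x                ∎
  where open ≡-Reasoning

1/-*-cancelˡ : ∀ t x .{{_ : NonZero t}} → 1/ t * (t * x) ≡ x
1/-*-cancelˡ t x = begin
  1/ t * (t * x)   ≡⟨ ℚ.*-assoc (1/ t) t x ⟨
  1/ t * t * x     ≡⟨ cong (_* x) (ℚ.*-inverseˡ t) ⟩
  1ℚ * x           ≡⟨ ℚ.*-identityˡ x ⟩
  x                ∎
  where open ≡-Reasoning

*-cancelˡ-≡0 : ∀ {t x} → t ≢ 0ℚ → t * x ≡ 0ℚ → x ≡ 0ℚ
*-cancelˡ-≡0 {t} {x} t≢0 tx≡0 = begin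
  x                ≡⟨ 1/-*-cancelˡ t x ⟨
  1/ t * (t * x)   ≡⟨ cong (1/ t *_) tx≡0 ⟩
  1/ t * 0ℚ        ≡⟨ ℚ.*-zeroʳ (1/ t) ⟩
  0ℚ               ∎
  where
  open ≡-Reasoning
  instance _ = ≢-nonZero t≢0

*-≢0 : ∀ {t w} → t ≢ 0ℚ → w ≢ 0ℚ → t * w ≢ 0ℚ
*-≢0 t≢0 w≢0 = w≢0 ∘ *-cancelˡ-≡0 t≢0

Primitive₂ : ∀ {n} → Vec ℚ n → Set
Primitive₂ zs = VecAll.All Integral₂ zs × VecAny.Any (λ z → reduce z ≡ 1ℙ) zs

rescale-by-head : ∀ {n} t w (zs : Vec ℚ n) .{{_ : NonZero w}} →
  Vec.map (t *_) (w ∷ zs) ≡ Vec.map ((t * w) *_) (1ℚ ∷ Vec.map (1/ w *_) zs)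
rescale-by-head t w zs = cong₂ _∷_ (sym (ℚ.*-identityʳ (t * w))) (begin
  Vec.map (t *_) zs                              ≡⟨ Vec.map-cong t*z≡tw*z/w zs ⟩
  Vec.map (((t * w) *_) ∘ (1/ w *_)) zs          ≡⟨ Vec.map-∘ ((t * w) *_) (1/ w *_) zs ⟩
  Vec.map ((t * w) *_) (Vec.map (1/ w *_) zs)    ∎)
  where
  open ≡-Reasoning
  t*z≡tw*z/w : ∀ z → t * z ≡ t * w * (1/ w * z)
  t*z≡tw*z/w z = begin
    t * z                  ≡⟨ cong (t *_) (*-1/-cancelˡ w z) ⟨
    t * (w * (1/ w * z))   ≡⟨ ℚ.*-assoc t w (1/ w * z) ⟨
    t * w * (1/ w * z)     ∎

PrimitiveMultiple : ∀ {n} → Vec ℚ n → Set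
PrimitiveMultiple xs = ∃[ t ] ∃[ zs ] (t ≢ 0ℚ × xs ≡ Vec.map (t *_) zs × Primitive₂ zs)

rescaled-primitive : ∀ {n t w} {xs : Vec ℚ (suc n)} (zs : Vec ℚ n) → t ≢ 0ℚ → (w≢0 : w ≢ 0ℚ) →
  VecAll.All Integral₂ (Vec.map ((1/ w) {{≢-nonZero w≢0}} *_) zs) → xs ≡ Vec.map (t *_) (w ∷ zs) →
  PrimitiveMultiple xs
rescaled-primitive {t = t} {w} zs t≢0 w≢0 zs/w-int xs≡t·wzs =
  t * w , 1ℚ ∷ Vec.map (1/ w *_) zs , *-≢0 t≢0 w≢0 , trans xs≡t·wzs (rescale-by-head t w zs) ,
  (refl ∷ zs/w-int) , here refl
  where instance _ = ≢-nonZero w≢0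

-- A head w that is not 2-integral has odd numerator, so dividing by it keeps the tail 2-integral.
cons-primitive : ∀ {n t w} {zs : Vec ℚ n} {xs} → t ≢ 0ℚ → Primitive₂ zs → xs ≡ Vec.map (t *_) (w ∷ zs) →
  PrimitiveMultiple xs
cons-primitive {t = t} {w} {zs} t≢0 (zs-int , zs-odd) xs≡t·wzs with parity (↧ₙ w) ℙ.≟ 1ℙ
... | yes w-int = t , w ∷ zs , t≢0 , xs≡t·wzs , (w-int ∷ zs-int) , there zs-odd
... | no ¬w-int = rescaled-primitive zs t≢0 w≢0 zs/w-int xs≡t·wzs
  where
  w≢0 : w ≢ 0ℚ
  w≢0 w≡0 = ¬w-int (subst Integral₂ (sym w≡0) refl)
  instance _ = ≢-nonZero w≢0
  zs/w-int : VecAll.All Integral₂ (Vec.map (1/ w *_) zs)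
  zs/w-int = VecAll.map⁺ (VecAll.map (Integral₂-* (1/ w) _ (Integral₂-1/ w ¬w-int)) zs-int)

zero-or-primitive-multiple : ∀ {n} (xs : Vec ℚ n) → VecAll.All (_≡ 0ℚ) xs ⊎ PrimitiveMultiple xs
zero-or-primitive-multiple [] = inj₁ []
zero-or-primitive-multiple (x ∷ ys) with zero-or-primitive-multiple ys
... | inj₂ (t , zs , t≢0 , ys≡t·zs , zs-primitive) =
  inj₂ (cons-primitive t≢0 zs-primitive (cong₂ _∷_ (sym (*-1/-cancelˡ t x)) ys≡t·zs))
  where instance _ = ≢-nonZero t≢0
... | inj₁ ys≡0 with x ℚ.≟ 0ℚ
...   | yes x≡0 = inj₁ (x≡0 ∷ ys≡0)
...   | no  x≢0 = inj₂ (rescaled-primitive ys ℚ.1≢0 x≢0 ys/x-int (sym 1·xys≡xys))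
  where
  instance _ = ≢-nonZero x≢0
  ys/x-int : VecAll.All Integral₂ (Vec.map (1/ x *_) ys)
  ys/x-int = VecAll.map⁺ (VecAll.map (λ y≡0 → subst Integral₂ (sym (y/x≡0 y≡0)) refl) ys≡0)
    where
    y/x≡0 : ∀ {y} → y ≡ 0ℚ → 1/ x * y ≡ 0ℚ
    y/x≡0 y≡0 = trans (cong (1/ x *_) y≡0) (ℚ.*-zeroʳ (1/ x))
  1·xys≡xys : Vec.map (1ℚ *_) (x ∷ ys) ≡ x ∷ ys
  1·xys≡xys = trans (Vec.map-cong ℚ.*-identityˡ (x ∷ ys)) (Vec.map-id (x ∷ ys))

primitive-multiple : ∀ {n} (xs : Vec ℚ n) → VecAny.Any (_≢ 0ℚ) xs →
  ∃[ t ] ∃[ zs ] (xs ≡ Vec.map (t *_) zs × Primitive₂ zs)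
primitive-multiple xs xs≢0 with zero-or-primitive-multiple xs
... | inj₁ xs≡0                         = ⊥-elim (no-nonzero xs≡0 xs≢0)
  where
  no-nonzero : ∀ {n} {xs : Vec ℚ n} → VecAll.All (_≡ 0ℚ) xs → ¬ VecAny.Any (_≢ 0ℚ) xs
  no-nonzero (x≡0 ∷ _)    (here x≢0)   = x≢0 x≡0
  no-nonzero (_ ∷ xs≡0)   (there xs≢0) = no-nonzero xs≡0 xs≢0
... | inj₂ (t , zs , _ , xs≡t·zs , zs-primitive) = t , zs , xs≡t·zs , zs-primitive

scaleF-scaleF : ∀ a b p → scaleF a (scaleF b p) ≡ scaleF (a * b) p
scaleF-scaleF a b p = trans (sym (List.map-∘ p)) (List.map-cong (λ x → sym (ℚ.*-assoc a b x)) p)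

scaleF-comm : ∀ a b p → scaleF a (scaleF b p) ≡ scaleF b (scaleF a p)
scaleF-comm a b p = begin
  scaleF a (scaleF b p)   ≡⟨ scaleF-scaleF a b p ⟩
  scaleF (a * b) p        ≡⟨ cong (λ c → scaleF c p) (ℚ.*-comm a b) ⟩
  scaleF (b * a) p        ≡⟨ scaleF-scaleF b a p ⟨
  scaleF b (scaleF a p)   ∎
  where open ≡-Reasoning

scaleF-addF : ∀ a p q → scaleF a (addF p q) ≡ addF (scaleF a p) (scaleF a q)
scaleF-addF a []      q       = refl
scaleF-addF a (x ∷ p) []      = refl
scaleF-addF a (x ∷ p) (y ∷ q) = cong₂ _∷_ (ℚ.*-distribˡ-+ a x y) (scaleF-addF a p q)

mulF-scaleˡ : ∀ a p q → mulF (scaleF a p) q ≡ scaleF a (mulF p q)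
mulF-scaleˡ a []      q = refl
mulF-scaleˡ a (x ∷ p) q = begin
  addF (scaleF (a * x) q) (0ℚ ∷ mulF (scaleF a p) q)          ≡⟨ cong₂ addF (scaleF-scaleF a x q) 0∷ap·q≡a·0∷pq ⟨
  addF (scaleF a (scaleF x q)) (scaleF a (0ℚ ∷ mulF p q))     ≡⟨ scaleF-addF a (scaleF x q) (0ℚ ∷ mulF p q) ⟨
  scaleF a (mulF (x ∷ p) q)                                   ∎
  where
  open ≡-Reasoning
  0∷ap·q≡a·0∷pq : scaleF a (0ℚ ∷ mulF p q) ≡ 0ℚ ∷ mulF (scaleF a p) q
  0∷ap·q≡a·0∷pq = cong₂ _∷_ (ℚ.*-zeroʳ a) (sym (mulF-scaleˡ a p q))

mulF-scaleʳ : ∀ a p q → mulF p (scaleF a q) ≡ scaleF a (mulF p q)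
mulF-scaleʳ a []      q = refl
mulF-scaleʳ a (x ∷ p) q = begin
  addF (scaleF x (scaleF a q)) (0ℚ ∷ mulF p (scaleF a q))     ≡⟨ cong₂ addF (scaleF-comm a x q) 0∷p·aq≡a·0∷pq ⟨
  addF (scaleF a (scaleF x q)) (scaleF a (0ℚ ∷ mulF p q))     ≡⟨ scaleF-addF a (scaleF x q) (0ℚ ∷ mulF p q) ⟨
  scaleF a (mulF (x ∷ p) q)                                   ∎
  where
  open ≡-Reasoning
  0∷p·aq≡a·0∷pq : scaleF a (0ℚ ∷ mulF p q) ≡ 0ℚ ∷ mulF p (scaleF a q)
  0∷p·aq≡a·0∷pq = cong₂ _∷_ (ℚ.*-zeroʳ a) (sym (mulF-scaleʳ a p q))

mulF-scaleF : ∀ s t p q → mulF (scaleF s p) (scaleF t q) ≡ scaleF (s * t) (mulF p q)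
mulF-scaleF s t p q = begin
  mulF (scaleF s p) (scaleF t q)   ≡⟨ mulF-scaleˡ s p (scaleF t q) ⟩
  scaleF s (mulF p (scaleF t q))   ≡⟨ cong (scaleF s) (mulF-scaleʳ t p q) ⟩
  scaleF s (scaleF t (mulF p q))   ≡⟨ scaleF-scaleF s t (mulF p q) ⟩
  scaleF (s * t) (mulF p q)        ∎
  where open ≡-Reasoning

record ScaledPrimitive {n} (form : Vec ℚ n → List ℚ) (G : List ℚ) : Set where
  constructor scaledPrimitive
  field
    scale          : ℚ
    base           : Vec ℚ n
    G≡scale·form   : G ≡ scaleF scale (form base)
    base-primitive : Primitive₂ base

nonzero-pair : ∀ {α β} → ¬ (α ≡ 0ℚ × β ≡ 0ℚ) → VecAny.Any (_≢ 0ℚ) (α ∷ β ∷ [])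
nonzero-pair {α} ¬α,β≡0 with α ℚ.≟ 0ℚ
... | no  α≢0 = here α≢0
... | yes α≡0 = there (here (λ β≡0 → ¬α,β≡0 (α≡0 , β≡0)))

line-scaledPrimitive : ∀ {L} → NonzeroLinear L → ScaledPrimitive {2} Vec.toList L
line-scaledPrimitive (α , β , refl , ¬α,β≡0) =
  let t , zs , αβ≡t·zs , zs-primitive = primitive-multiple (α ∷ β ∷ []) (nonzero-pair ¬α,β≡0)
  in scaledPrimitive t zs (trans (cong Vec.toList αβ≡t·zs) (Vec.toList-map (t *_) zs)) zs-primitive

-- Quadratic forms with a root in ℚ(ζ₃)

-- normForm (c , a , b) = N(c X − (a + b ω) Z), the norm from ℚ(ζ₃) of the line through (a + b ω) / c.
normForm : Vec ℚ 3 → List ℚ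
normForm (c ∷ a ∷ b ∷ []) = c * c ∷ c * (b - (a + a)) ∷ a * a - a * b + b * b ∷ []

normForm₂ : Vec Parity 3 → List Parity
normForm₂ (c ∷ a ∷ b ∷ []) = c ℙ.* c ∷ c ℙ.* (b ℙ.+ (a ℙ.+ a)) ∷ (a ℙ.* a) ℙ.+ (a ℙ.* b) ℙ.+ (b ℙ.* b) ∷ []

normForm-↦ₚ : ∀ {c a b c₂ a₂ b₂} → c ↦₂ c₂ → a ↦₂ a₂ → b ↦₂ b₂ →
  normForm (c ∷ a ∷ b ∷ []) ↦ₚ normForm₂ (c₂ ∷ a₂ ∷ b₂ ∷ [])
normForm-↦ₚ c↦ a↦ b↦ =
  ↦₂-* c↦ c↦ ∷ ↦₂-* c↦ (↦₂-- b↦ (↦₂-+ a↦ a↦)) ∷ ↦₂-+ (↦₂-- (↦₂-* a↦ a↦) (↦₂-* a↦ b↦)) (↦₂-* b↦ b↦) ∷ []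

normForm-homogeneous : ∀ t zs → normForm (Vec.map (t *_) zs) ≡ scaleF (t * t) (normForm zs)
normForm-homogeneous t (c ∷ a ∷ b ∷ []) = cong₂ _∷_
  (solve 2 (λ t c → (t :* c) :* (t :* c) := (t :* t) :* (c :* c)) refl t c) (cong₂ _∷_
  (solve 4 (λ t c a b → (t :* c) :* (t :* b :- (t :* a :+ t :* a)) := (t :* t) :* (c :* (b :- (a :+ a)))) refl t c a b)
  (cong₂ _∷_
  (solve 3 (λ t a b → (t :* a) :* (t :* a) :- (t :* a) :* (t :* b) :+ (t :* b) :* (t :* b)
                      := (t :* t) :* (a :* a :- a :* b :+ b :* b)) refl t a b)
  refl))
  where open +-*-Solver

-- Over 𝔽₂ a nonzero norm form is a square or X² + XZ + Z², so a product of two has a repeated factor.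
two-normForms₂ : ∀ c a b c′ a′ b′ → Nonzero₂ (c ∷ a ∷ b ∷ []) → Nonzero₂ (c′ ∷ a′ ∷ b′ ∷ []) →
  Inseparable₂ (mulF₂ (normForm₂ (c ∷ a ∷ b ∷ [])) (normForm₂ (c′ ∷ a′ ∷ b′ ∷ [])))
two-normForms₂ = from-yes
  ( ∀-Parity? λ c → ∀-Parity? λ a → ∀-Parity? λ b → ∀-Parity? λ c′ → ∀-Parity? λ a′ → ∀-Parity? λ b′ →
    nonzero₂? (c ∷ a ∷ b ∷ []) →-dec nonzero₂? (c′ ∷ a′ ∷ b′ ∷ []) →-dec
    inseparable₂? (mulF₂ (normForm₂ (c ∷ a ∷ b ∷ [])) (normForm₂ (c′ ∷ a′ ∷ b′ ∷ []))))

module _ where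
  open +-*-Solver

  -- ℚ(ζ₃) arithmetic on pairs of solver polynomials, so that solve sees the terms ι, _⊕_ and _⊗_ compute.
  private
    ιᴾ : ∀ {n} → Polynomial n → Polynomial n × Polynomial n
    ιᴾ a = a , con 0ℚ

    _⊕ᴾ_ _⊗ᴾ_ : ∀ {n} → Polynomial n × Polynomial n → Polynomial n × Polynomial n → Polynomial n × Polynomial n
    (a , b) ⊕ᴾ (c , d) = a :+ c , b :+ d
    (a , b) ⊗ᴾ (c , d) = a :* c :- b :* d , a :* d :+ b :* c :- b :* d

    infixl 6 _⊕ᴾ_
    infixl 7 _⊗ᴾ_

  quadratic-at : ∀ g₀ g₁ g₂ u v →
    ι g₀ ⊗ (u + v ω) ⊗ (u + v ω) ⊕ ι g₁ ⊗ (u + v ω) ⊕ ι g₂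
      ≡ (g₀ * (u * u - v * v) + g₁ * u + g₂) + (v * (g₀ * ((u + u) - v) + g₁)) ω
  quadratic-at g₀ g₁ g₂ u v = cong₂ _+_ω
    (solve 5 (λ g₀ g₁ g₂ u v → proj₁ (value g₀ g₁ g₂ u v) := g₀ :* (u :* u :- v :* v) :+ g₁ :* u :+ g₂) refl g₀ g₁ g₂ u v)
    (solve 5 (λ g₀ g₁ g₂ u v → proj₂ (value g₀ g₁ g₂ u v) := v :* (g₀ :* ((u :+ u) :- v) :+ g₁)) refl g₀ g₁ g₂ u v)
    where
    value : ∀ {n} → (g₀ g₁ g₂ u v : Polynomial n) → Polynomial n × Polynomial n
    value g₀ g₁ g₂ u v = ιᴾ g₀ ⊗ᴾ (u , v) ⊗ᴾ (u , v) ⊕ᴾ ιᴾ g₁ ⊗ᴾ (u , v) ⊕ᴾ ιᴾ g₂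

root-components : ∀ g₀ g₁ g₂ u v → ι g₀ ⊗ (u + v ω) ⊗ (u + v ω) ⊕ ι g₁ ⊗ (u + v ω) ⊕ ι g₂ ≡ 0ζ →
  g₀ * (u * u - v * v) + g₁ * u + g₂ ≡ 0ℚ × v * (g₀ * ((u + u) - v) + g₁) ≡ 0ℚ
root-components g₀ g₁ g₂ u v root = cong ℚζ₃.re value≡0 , cong ℚζ₃.im value≡0
  where value≡0 = trans (sym (quadratic-at g₀ g₁ g₂ u v)) root

drop-vanishing : ∀ {x y} e → x ≡ e + y → e ≡ 0ℚ → x ≡ y
drop-vanishing {y = y} e x≡e+y e≡0 = trans x≡e+y (trans (cong (_+ y) e≡0) (ℚ.+-identityˡ y))

factor-theorem : ∀ g₀ g₁ g₂ u → g₀ * (u * u) + g₁ * u + g₂ ≡ 0ℚ →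
  g₀ ∷ g₁ ∷ g₂ ∷ [] ≡ mulF (1ℚ ∷ - u ∷ []) (g₀ ∷ g₁ + g₀ * u ∷ [])
factor-theorem g₀ g₁ g₂ u u-root = cong₂ _∷_
  (solve 1 (λ g₀ → g₀ := con 1ℚ :* g₀ :+ con 0ℚ) refl g₀) (cong₂ _∷_
  (solve 3 (λ g₀ g₁ u → g₁ := con 1ℚ :* (g₁ :+ g₀ :* u) :+ (:- u :* g₀ :+ con 0ℚ)) refl g₀ g₁ u) (cong₂ _∷_
  (drop-vanishing (g₀ * (u * u) + g₁ * u + g₂)
    (solve 4 (λ g₀ g₁ g₂ u → g₂ := (g₀ :* (u :* u) :+ g₁ :* u :+ g₂) :+ :- u :* (g₁ :+ g₀ :* u)) refl g₀ g₁ g₂ u)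
    u-root)
  refl))
  where open +-*-Solver

-- Write k = g₀ (2u − v) + g₁ for the ω-coefficient divided by v; then g₁ and g₂ are read off from k = 0 and
-- from the 1-coefficient minus u k.
ζ₃-root⇒normForm-multiple : ∀ {g₀ g₁ g₂ u v} → v ≢ 0ℚ →
  g₀ * (u * u - v * v) + g₁ * u + g₂ ≡ 0ℚ → v * (g₀ * ((u + u) - v) + g₁) ≡ 0ℚ →
  g₀ ∷ g₁ ∷ g₂ ∷ [] ≡ scaleF g₀ (normForm (1ℚ ∷ u ∷ v ∷ []))
ζ₃-root⇒normForm-multiple {g₀} {g₁} {g₂} {u} {v} v≢0 re≡0 im≡0 = cong₂ _∷_
  (solve 1 (λ g₀ → g₀ := g₀ :* (con 1ℚ :* con 1ℚ)) refl g₀) (cong₂ _∷_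
  (drop-vanishing k
    (solve 4 (λ g₀ g₁ u v → g₁ := (g₀ :* ((u :+ u) :- v) :+ g₁) :+ g₀ :* (con 1ℚ :* (v :- (u :+ u)))) refl g₀ g₁ u v)
    k≡0) (cong₂ _∷_
  (drop-vanishing (g₀ * (u * u - v * v) + g₁ * u + g₂ - u * k)
    (solve 5 (λ g₀ g₁ g₂ u v → g₂ := (g₀ :* (u :* u :- v :* v) :+ g₁ :* u :+ g₂ :- u :* (g₀ :* ((u :+ u) :- v) :+ g₁))
                                     :+ g₀ :* (u :* u :- u :* v :+ v :* v)) refl g₀ g₁ g₂ u v)
    (trans (cong₂ (λ x y → x - u * y) re≡0 k≡0) (solve 1 (λ u → con 0ℚ :- u :* con 0ℚ := con 0ℚ) refl u)))
  refl))
  where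
  open +-*-Solver
  k = g₀ * ((u + u) - v) + g₁
  k≡0 : k ≡ 0ℚ
  k≡0 = *-cancelˡ-≡0 v≢0 im≡0

ζ₃-root-scaledPrimitive : ∀ g₀ g₁ g₂ u v → IrreducibleQuad (g₀ ∷ g₁ ∷ g₂ ∷ []) →
  g₀ * (u * u - v * v) + g₁ * u + g₂ ≡ 0ℚ → v * (g₀ * ((u + u) - v) + g₁) ≡ 0ℚ →
  ScaledPrimitive normForm (g₀ ∷ g₁ ∷ g₂ ∷ [])
ζ₃-root-scaledPrimitive g₀ g₁ g₂ u v (_ , _ , _ , _ , _ , irreducible) re≡0 im≡0 with v ℚ.≟ 0ℚ
... | yes v≡0 = ⊥-elim (irreducible (1ℚ , - u , g₀ , g₁ + g₀ * u , factor-theorem g₀ g₁ g₂ u u-root))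
  where
  open +-*-Solver
  u-root : g₀ * (u * u) + g₁ * u + g₂ ≡ 0ℚ
  u-root = trans
    (solve 4 (λ g₀ g₁ g₂ u → g₀ :* (u :* u) :+ g₁ :* u :+ g₂ := g₀ :* (u :* u :- con 0ℚ :* con 0ℚ) :+ g₁ :* u :+ g₂)
       refl g₀ g₁ g₂ u)
    (subst (λ v → g₀ * (u * u - v * v) + g₁ * u + g₂ ≡ 0ℚ) v≡0 re≡0)
... | no v≢0  =
  let t , zs , 1uv≡t·zs , zs-primitive = primitive-multiple (1ℚ ∷ u ∷ v ∷ []) (here ℚ.1≢0)
  in scaledPrimitive (g₀ * (t * t)) zs (G≡ t zs 1uv≡t·zs) zs-primitive
  where
  open ≡-Reasoning
  G≡ : ∀ t zs → 1ℚ ∷ u ∷ v ∷ [] ≡ Vec.map (t *_) zs → g₀ ∷ g₁ ∷ g₂ ∷ [] ≡ scaleF (g₀ * (t * t)) (normForm zs)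
  G≡ t zs 1uv≡t·zs = begin
    g₀ ∷ g₁ ∷ g₂ ∷ []                               ≡⟨ ζ₃-root⇒normForm-multiple v≢0 re≡0 im≡0 ⟩
    scaleF g₀ (normForm (1ℚ ∷ u ∷ v ∷ []))          ≡⟨ cong (scaleF g₀ ∘ normForm) 1uv≡t·zs ⟩
    scaleF g₀ (normForm (Vec.map (t *_) zs))        ≡⟨ cong (scaleF g₀) (normForm-homogeneous t zs) ⟩
    scaleF g₀ (scaleF (t * t) (normForm zs))        ≡⟨ scaleF-scaleF g₀ (t * t) (normForm zs) ⟩
    scaleF (g₀ * (t * t)) (normForm zs)             ∎

ζ₃-quadratic-scaledPrimitive : ∀ {G} → IrreducibleQuad G → HasRootInℚζ₃ G → ScaledPrimitive normForm G
ζ₃-quadratic-scaledPrimitive irreducible (g₀ , g₁ , g₂ , refl , u + v ω , root) =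
  let re≡0 , im≡0 = root-components g₀ g₁ g₂ u v root in ζ₃-root-scaledPrimitive g₀ g₁ g₂ u v irreducible re≡0 im≡0

mulF-of-multiples : ∀ {A B} s A′ t B′ → A ≡ scaleF s A′ → B ≡ scaleF t B′ →
  mulF A B ≡ scaleF (s * t) (mulF A′ B′)
mulF-of-multiples s A′ t B′ A≡sA′ B≡tB′ = trans (cong₂ mulF A≡sA′ B≡tB′) (mulF-scaleF s t A′ B′)

¬FieldSystemQQQQ : ∀ {a b c d e} → All Integral₂ (quartic a b c d e) → reduce (disc4 a b c d e) ≡ 1ℙ →
  ¬ FieldSystemQQQQ (quartic a b c d e)
¬FieldSystemQQQQ {a} {b} {c} {d} {e} F-int disc-odd (λ′ , L₁ , L₂ , L₃ , L₄ , _ , l₁ , l₂ , l₃ , l₄ , F≡λ′L₁L₂L₃L₄) =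
  four-lines (line-scaledPrimitive l₁) (line-scaledPrimitive l₂) (line-scaledPrimitive l₃) (line-scaledPrimitive l₄)
  where
  line-↦ₚ : ∀ α β → Integral₂ α → Integral₂ β → α ∷ β ∷ [] ↦ₚ reduce α ∷ reduce β ∷ []
  line-↦ₚ α β α-int β-int = ↦₂-reduce α α-int ∷ ↦₂-reduce β β-int ∷ []

  four-lines : ScaledPrimitive {2} Vec.toList L₁ → ScaledPrimitive {2} Vec.toList L₂ →
               ScaledPrimitive {2} Vec.toList L₃ → ScaledPrimitive {2} Vec.toList L₄ → ⊥
  four-lines (scaledPrimitive t₁ (α₁ ∷ β₁ ∷ []) L₁≡ (α₁-int ∷ β₁-int ∷ [] , odd₁))
             (scaledPrimitive t₂ (α₂ ∷ β₂ ∷ []) L₂≡ (α₂-int ∷ β₂-int ∷ [] , odd₂))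
             (scaledPrimitive t₃ (α₃ ∷ β₃ ∷ []) L₃≡ (α₃-int ∷ β₃-int ∷ [] , odd₃))
             (scaledPrimitive t₄ (α₄ ∷ β₄ ∷ []) L₄≡ (α₄-int ∷ β₄-int ∷ [] , odd₄)) =
    good-reduction⇒separable F-int disc-odd (λ′ * T) F≡λ′T·P
      (mulF-↦ₚ (line-↦ₚ α₁ β₁ α₁-int β₁-int) (mulF-↦ₚ (line-↦ₚ α₂ β₂ α₂-int β₂-int)
        (mulF-↦ₚ (line-↦ₚ α₃ β₃ α₃-int β₃-int) (line-↦ₚ α₄ β₄ α₄-int β₄-int))))
      (four-lines₂ _ _ _ _ _ _ _ _ (VecAny.map⁺ odd₁) (VecAny.map⁺ odd₂) (VecAny.map⁺ odd₃) (VecAny.map⁺ odd₄))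
    where
    M₁ M₂ M₃ M₄ P : List ℚ
    M₁ = α₁ ∷ β₁ ∷ []
    M₂ = α₂ ∷ β₂ ∷ []
    M₃ = α₃ ∷ β₃ ∷ []
    M₄ = α₄ ∷ β₄ ∷ []
    P  = mulF M₁ (mulF M₂ (mulF M₃ M₄))
    T : ℚ
    T = t₁ * (t₂ * (t₃ * t₄))
    L₁L₂L₃L₄≡T·P : mulF L₁ (mulF L₂ (mulF L₃ L₄)) ≡ scaleF T P
    L₁L₂L₃L₄≡T·P =
      mulF-of-multiples t₁ M₁ _ _ L₁≡ (mulF-of-multiples t₂ M₂ _ _ L₂≡ (mulF-of-multiples t₃ M₃ t₄ M₄ L₃≡ L₄≡))
    F≡λ′T·P : quartic a b c d e ≡ scaleF (λ′ * T) P
    F≡λ′T·P = trans F≡λ′L₁L₂L₃L₄ (trans (cong (scaleF λ′) L₁L₂L₃L₄≡T·P) (scaleF-scaleF λ′ T P))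

¬FieldSystemZetaZeta : ∀ {a b c d e} → All Integral₂ (quartic a b c d e) → reduce (disc4 a b c d e) ≡ 1ℙ →
  ¬ FieldSystemZetaZeta (quartic a b c d e)
¬FieldSystemZetaZeta {a} {b} {c} {d} {e} F-int disc-odd (λ′ , G₁ , G₂ , _ , irr₁ , root₁ , irr₂ , root₂ , F≡λ′G₁G₂) =
  two-normForms (ζ₃-quadratic-scaledPrimitive irr₁ root₁) (ζ₃-quadratic-scaledPrimitive irr₂ root₂)
  where
  two-normForms : ScaledPrimitive normForm G₁ → ScaledPrimitive normForm G₂ → ⊥
  two-normForms (scaledPrimitive κ₁ (c₁ ∷ a₁ ∷ b₁ ∷ []) G₁≡ (c₁-int ∷ a₁-int ∷ b₁-int ∷ [] , odd₁))
                (scaledPrimitive κ₂ (c₂ ∷ a₂ ∷ b₂ ∷ []) G₂≡ (c₂-int ∷ a₂-int ∷ b₂-int ∷ [] , odd₂)) =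
    good-reduction⇒separable F-int disc-odd (λ′ * (κ₁ * κ₂)) F≡λ′κ·P
      (mulF-↦ₚ (normForm-↦ₚ (↦₂-reduce c₁ c₁-int) (↦₂-reduce a₁ a₁-int) (↦₂-reduce b₁ b₁-int))
               (normForm-↦ₚ (↦₂-reduce c₂ c₂-int) (↦₂-reduce a₂ a₂-int) (↦₂-reduce b₂ b₂-int)))
      (two-normForms₂ _ _ _ _ _ _ (VecAny.map⁺ odd₁) (VecAny.map⁺ odd₂))
    where
    N₁ N₂ : List ℚ
    N₁ = normForm (c₁ ∷ a₁ ∷ b₁ ∷ [])
    N₂ = normForm (c₂ ∷ a₂ ∷ b₂ ∷ [])
    F≡λ′κ·P : quartic a b c d e ≡ scaleF (λ′ * (κ₁ * κ₂)) (mulF N₁ N₂)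
    F≡λ′κ·P = trans F≡λ′G₁G₂
      (trans (cong (scaleF λ′) (mulF-of-multiples κ₁ N₁ κ₂ N₂ G₁≡ G₂≡)) (scaleF-scaleF λ′ (κ₁ * κ₂) (mulF N₁ N₂)))

lemma6p6 : (a b c d e : ℚ)
    → InZ3 a → InZ3 b → InZ3 c → InZ3 d → InZ3 e
    → IsUnitZ3 (disc4 a b c d e)
    → ¬ FieldSystemQQQQ (quartic a b c d e) × ¬ FieldSystemZetaZeta (quartic a b c d e)
lemma6p6 a b c d e a∈ b∈ c∈ d∈ e∈ disc-unit = ¬FieldSystemQQQQ F-int disc-odd , ¬FieldSystemZetaZeta F-int disc-odd
  where
  F-int : All Integral₂ (quartic a b c d e)
  F-int = InZ3⇒Integral₂ a a∈ ∷ InZ3⇒Integral₂ b b∈ ∷ InZ3⇒Integral₂ c c∈ ∷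
          InZ3⇒Integral₂ d d∈ ∷ InZ3⇒Integral₂ e e∈ ∷ []
  disc-odd : reduce (disc4 a b c d e) ≡ 1ℙ
  disc-odd = IsUnitZ3⇒reduce≡1ℙ (disc4 a b c d e) disc-unit
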